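{- Given a model $F:\mathrm{Syn}(\mathsf{CaTT})\to\mathbf{Set}$ of the type theory $\mathsf{CaTT}$, the functor $F\circ\Sigma_r:\mathrm{Syn}(\mathsf{MCaTT})\to\mathbf{Set}$ preserves the pullbacks along display maps of $\mathrm{Syn}(\mathsf{MCaTT})$.
   Context: $\mathsf{CaTT}$ is the Finster–Mimram type theory for weak $\omega$-categories (types $\star$, $\mathrm{Hom}_Atu$; terms variables, $\mathsf{op}$, $\mathsf{coh}$ indexed by ps-contexts). $\mathsf{MCaTT}$ is the type theory with a unit type $\mathbb{1}$ (constant $()$, $\eta$-rule), types $\mathrm{Hom}_Atu$ ($\star$ abbreviating $\mathrm{Hom}_{\mathbb{1}}()()$) and term constructors $\mathsf{mop}$, $\mathsf{mcoh}$. $\mathrm{Syn}(T)$ is the syntactic category with families of $T$; display maps are the projections $(\Gamma,x:A)\to\Gamma$, and a model of a category with families is a functor to $\mathbf{Set}$ preserving the terminal object and pullbacks along display maps. The reduced suspension functor $\Sigma_r:\mathrm{Syn}(\mathsf{MCaTT})\to\mathrm{Syn}(\mathsf{CaTT})$ adds a fresh variable $\bullet:\star$ ($\Sigma_r\emptyset=(\bullet:\star)$), sets $\Sigma_r(\Gamma,x:\mathbb{1})=\Sigma_r\Gamma$ and $\Sigma_r(\Gamma,x:A)=(\Sigma_r\Gamma,x:\Sigma_rA)$ for $A\neq\mathbb{1}$, sends $\mathbb{1}$ to $\star$, $()$ to $\bullet$, $\star$ to $\mathrm{Hom}_\star\bullet\bullet$, and $\mathsf{mop}_{\Theta,A}[\gamma]$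 to $\mathsf{op}_{\Theta,A}[\bullet_\Theta\circ\Sigma_r\gamma]$ (similarly for $\mathsf{mcoh}$); it commutes with substitution, $\Sigma_r(A[\gamma])=(\Sigma_rA)[\Sigma_r\gamma]$. -}

module Defs where

open import Data.Nat using (ℕ; zero; suc; _⊔_; _≤?_)
open import Data.Nat.Properties using (<-cmp)
open import Data.Fin using (Fin; zero; suc)
open import Data.Fin.Subset using (Subset; ⁅_⁆; _∪_; inside; outside)
  renaming (⊤ to Full; ⊥ to Empty)
open import Data.Vec using ([]; _∷_)
open import Data.Product using (Σ; _×_; _,_)
open import Relation.Nullary using (yes; no)
open import Relation.Binary using (tri<; tri≈; tri>)
open import Relation.Binary.PropositionalEquality using (_≡_)

-- A context of length n is a snoc-list; variable  zero  is the LAST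
-- (most recently added) variable.  A substitution  σ : Sub m k  from a
-- context of length m to a context of length k is a snoc-list of k
-- terms in scope m; its last entry is the image of variable zero.
-- "Δ ⊢ σ ∶ˢ Γ" is a morphism  Δ → Γ  of the syntactic category.
-- Variable sets are  Subset n  (Vec Bool n); position i of the vector
-- is de Bruijn variable i.

mutual
  data CTy (n : ℕ) : Set where
    ⋆   : CTy n
    Hom : CTy n → CTm n → CTm n → CTy n

  data CTm (n : ℕ) : Set where
    var : Fin n → CTm n
    op  : ∀ {k} → CCtx k → CTy k → CSub n k → CTm n
    coh : ∀ {k} → CCtx k → CTy k → CSub n k → CTm n

  data CSub (n : ℕ) : ℕ → Set where
    ⟨⟩  : CSub n 0
    _,ᶜ_ : ∀ {k} → CSub n k → CTm n → CSub n (suc k)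

  data CCtx : ℕ → Set where
    ∅   : CCtx 0
    _▸_ : ∀ {n} → CCtx n → CTy n → CCtx (suc n)

infixl 5 _▸_ _,ᶜ_

lookupᶜ : ∀ {m n} → CSub m n → Fin n → CTm m
lookupᶜ (σ ,ᶜ t) zero    = t
lookupᶜ (σ ,ᶜ t) (suc i) = lookupᶜ σ i

tabᶜ : ∀ {m n} → (Fin n → CTm m) → CSub m n
tabᶜ {n = zero}  f = ⟨⟩
tabᶜ {n = suc n} f = tabᶜ (λ i → f (suc i)) ,ᶜ f zero

-- application of substitutions;  τ ∘ᶜ σ  is the composite in Syn(CaTT)
-- (first σ, then τ), i.e. τ with σ applied to every entry.
mutual
  _[_]ᶜT : ∀ {m n} → CTy n → CSub m n → CTy m
  ⋆ [ σ ]ᶜT         = ⋆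
  Hom A t u [ σ ]ᶜT = Hom (A [ σ ]ᶜT) (t [ σ ]ᶜt) (u [ σ ]ᶜt)

  _[_]ᶜt : ∀ {m n} → CTm n → CSub m n → CTm m
  var i [ σ ]ᶜt       = lookupᶜ σ i
  op Θ A τ [ σ ]ᶜt    = op Θ A (τ ∘ᶜ σ)
  coh Θ A τ [ σ ]ᶜt   = coh Θ A (τ ∘ᶜ σ)

  _∘ᶜ_ : ∀ {m n k} → CSub n k → CSub m n → CSub m k
  ⟨⟩ ∘ᶜ σ      = ⟨⟩
  (τ ,ᶜ t) ∘ᶜ σ = (τ ∘ᶜ σ) ,ᶜ (t [ σ ]ᶜt)

idᶜ : ∀ {n} → CSub n n
idᶜ = tabᶜ var

pᶜ : ∀ {n} → CSub (suc n) n
pᶜ = tabᶜ (λ i → var (suc i))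

wkᶜT : ∀ {n} → CTy n → CTy (suc n)
wkᶜT A = A [ pᶜ ]ᶜT

lookupTyᶜ : ∀ {n} → CCtx n → Fin n → CTy n
lookupTyᶜ (Γ ▸ A) zero    = wkᶜT A
lookupTyᶜ (Γ ▸ A) (suc i) = wkᶜT (lookupTyᶜ Γ i)

dimT : ∀ {n} → CTy n → ℕ
dimT ⋆           = 0
dimT (Hom A _ _) = suc (dimT A)

dimC : ∀ {n} → CCtx n → ℕ
dimC ∅       = 0
dimC (Γ ▸ A) = dimC Γ ⊔ dimT A

mutual
  FVt : ∀ {n} → CTm n → Subset n
  FVt (var i)     = ⁅ i ⁆
  FVt (op Θ A σ)  = FVs σ
  FVt (coh Θ A σ) = FVs σ

  FVs : ∀ {n k} → CSub n k → Subset n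
  FVs ⟨⟩      = Empty
  FVs (σ ,ᶜ t) = FVs σ ∪ FVt t

FVT : ∀ {n} → CTy n → Subset n
FVT ⋆           = Empty
FVT (Hom A t u) = (FVT A ∪ FVt t) ∪ FVt u

Var : ∀ {n} → CTm n → CTy n → Subset n
Var t A = FVt t ∪ FVT A

dropLast : ∀ {n} → Subset n → Subset n
dropLast []            = []
dropLast (inside ∷ s)  = outside ∷ s
dropLast (outside ∷ s) = outside ∷ dropLast s

-- source and target boundaries ∂⁻_i, ∂⁺_i of a ps-context (as variable
-- sets), following Finster–Mimram: a ps-context is (x:⋆) or
-- (Γ , y : A , f : Hom_A x y); in de Bruijn form f is variable 0 and
-- y is variable 1.
∂⁻ : ∀ {n} → ℕ → CCtx n → Subset n
∂⁻ i ∅               = []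
∂⁻ i (∅ ▸ A)         = inside ∷ []
∂⁻ i ((Γ ▸ A) ▸ B) with i ≤? dimT A
... | yes _ = outside ∷ outside ∷ ∂⁻ i Γ
... | no  _ = inside ∷ inside ∷ ∂⁻ i Γ

∂⁺ : ∀ {n} → ℕ → CCtx n → Subset n
∂⁺ i ∅               = []
∂⁺ i (∅ ▸ A)         = inside ∷ []
∂⁺ i ((Γ ▸ A) ▸ B) with <-cmp i (dimT A)
... | tri< _ _ _ = outside ∷ outside ∷ ∂⁺ i Γ
... | tri≈ _ _ _ = outside ∷ inside ∷ dropLast (∂⁺ i Γ)
... | tri> _ _ _ = inside ∷ inside ∷ ∂⁺ i Γ

data _⊢ps_∶_ : ∀ {n} → CCtx n → Fin n → CTy n → Set where
  pss : (∅ ▸ ⋆) ⊢ps zero ∶ ⋆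
  pse : ∀ {n} {Γ : CCtx n} {x A} → Γ ⊢ps x ∶ A →
        ((Γ ▸ A) ▸ Hom (wkᶜT A) (var (suc x)) (var zero))
          ⊢ps zero ∶ wkᶜT (Hom (wkᶜT A) (var (suc x)) (var zero))
  psd : ∀ {n} {Γ : CCtx n} {f x y A} → Γ ⊢ps f ∶ Hom A (var x) (var y) →
        Γ ⊢ps y ∶ A

data _⊢ps {n} (Γ : CCtx n) : Set where
  ps : ∀ {x} → Γ ⊢ps x ∶ ⋆ → Γ ⊢ps

mutual
  data _⊢ᶜ : ∀ {n} → CCtx n → Set where
    ∅ᶜ : ∅ ⊢ᶜ
    ▸ᶜ : ∀ {n} {Γ : CCtx n} {A} → Γ ⊢ᶜ A → (Γ ▸ A) ⊢ᶜ

  data _⊢ᶜ_ {n} (Γ : CCtx n) : CTy n → Set where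
    ⋆ᶜ   : Γ ⊢ᶜ → Γ ⊢ᶜ ⋆
    Homᶜ : ∀ {A t u} → Γ ⊢ᶜ t ∶ A → Γ ⊢ᶜ u ∶ A → Γ ⊢ᶜ Hom A t u

  data _⊢ᶜ_∶_ {n} (Γ : CCtx n) : CTm n → CTy n → Set where
    varᶜ : ∀ {i A} → Γ ⊢ᶜ → lookupTyᶜ Γ i ≡ A → Γ ⊢ᶜ var i ∶ A
    opᶜ  : ∀ {k} {Θ : CCtx k} {A σ B} → OpCond Θ A → Γ ⊢ᶜ σ ∶ˢ Θ →
           A [ σ ]ᶜT ≡ B → Γ ⊢ᶜ op Θ A σ ∶ B
    cohᶜ : ∀ {k} {Θ : CCtx k} {A σ B} → CohCond Θ A → Γ ⊢ᶜ σ ∶ˢ Θ →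
           A [ σ ]ᶜT ≡ B → Γ ⊢ᶜ coh Θ A σ ∶ B

  data _⊢ᶜ_∶ˢ_ {m} (Δ : CCtx m) : ∀ {k} → CSub m k → CCtx k → Set where
    ⟨⟩ᶜ : Δ ⊢ᶜ → Δ ⊢ᶜ ⟨⟩ ∶ˢ ∅
    extᶜ : ∀ {k} {Γ : CCtx k} {σ A t} → Δ ⊢ᶜ σ ∶ˢ Γ → Γ ⊢ᶜ A →
          Δ ⊢ᶜ t ∶ (A [ σ ]ᶜT) → Δ ⊢ᶜ (σ ,ᶜ t) ∶ˢ (Γ ▸ A)

  -- side condition of the "op" rule:  Var(t:A) = Var(∂⁻Θ),
  -- Var(u:A) = Var(∂⁺Θ), boundaries taken in dimension dim Θ - 1
  data OpCond {k} (Θ : CCtx k) : CTy k → Set where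
    opc : ∀ {A t u d} → Θ ⊢ps → Θ ⊢ᶜ t ∶ A → Θ ⊢ᶜ u ∶ A →
          dimC Θ ≡ suc d → Var t A ≡ ∂⁻ d Θ → Var u A ≡ ∂⁺ d Θ →
          OpCond Θ (Hom A t u)

  data CohCond {k} (Θ : CCtx k) : CTy k → Set where
    cohc : ∀ {A t u} → Θ ⊢ps → Θ ⊢ᶜ t ∶ A → Θ ⊢ᶜ u ∶ A →
           Var t A ≡ Full → Var u A ≡ Full →
           CohCond Θ (Hom A t u)

mutual
  data MTy (n : ℕ) : Set where
    𝟙    : MTy n
    Homᵐ : MTy n → MTm n → MTm n → MTy n

  data MTm (n : ℕ) : Set where
    mvar : Fin n → MTm n
    unit : MTm n
    -- mop_{Θ,A}[γ], mcoh_{Θ,A}[γ] with Θ a (CaTT) ps-context and A a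
    -- CaTT type over Θ; γ is a substitution into ↓Θ (see below)
    mop  : ∀ {k} → CCtx k → CTy k → MSub n k → MTm n
    mcoh : ∀ {k} → CCtx k → CTy k → MSub n k → MTm n

  data MSub (n : ℕ) : ℕ → Set where
    ⟨⟩ₘ  : MSub n 0
    _,ₘ_ : ∀ {k} → MSub n k → MTm n → MSub n (suc k)

data MCtx : ℕ → Set where
  ∅ₘ   : MCtx 0
  _▸ₘ_ : ∀ {n} → MCtx n → MTy n → MCtx (suc n)

infixl 5 _▸ₘ_ _,ₘ_

-- ⋆ of MCaTT abbreviates Hom_𝟙 () ()
⋆ₘ : ∀ {n} → MTy n
⋆ₘ = Homᵐ 𝟙 unit unit

lookupₘ : ∀ {m n} → MSub m n → Fin n → MTm m
lookupₘ (σ ,ₘ t) zero    = t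
lookupₘ (σ ,ₘ t) (suc i) = lookupₘ σ i

tabₘ : ∀ {m n} → (Fin n → MTm m) → MSub m n
tabₘ {n = zero}  f = ⟨⟩ₘ
tabₘ {n = suc n} f = tabₘ (λ i → f (suc i)) ,ₘ f zero

mutual
  _[_]ᵐT : ∀ {m n} → MTy n → MSub m n → MTy m
  𝟙 [ σ ]ᵐT          = 𝟙
  Homᵐ A t u [ σ ]ᵐT = Homᵐ (A [ σ ]ᵐT) (t [ σ ]ᵐt) (u [ σ ]ᵐt)

  _[_]ᵐt : ∀ {m n} → MTm n → MSub m n → MTm m
  mvar i [ σ ]ᵐt     = lookupₘ σ i
  unit [ σ ]ᵐt       = unit
  mop Θ A τ [ σ ]ᵐt  = mop Θ A (τ ∘ₘ σ)
  mcoh Θ A τ [ σ ]ᵐt = mcoh Θ A (τ ∘ₘ σ)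

  _∘ₘ_ : ∀ {m n k} → MSub n k → MSub m n → MSub m k
  ⟨⟩ₘ ∘ₘ σ       = ⟨⟩ₘ
  (τ ,ₘ t) ∘ₘ σ  = (τ ∘ₘ σ) ,ₘ (t [ σ ]ᵐt)

pₘ : ∀ {n} → MSub (suc n) n
pₘ = tabₘ (λ i → mvar (suc i))

wkᵐT : ∀ {n} → MTy n → MTy (suc n)
wkᵐT A = A [ pₘ ]ᵐT

lookupTyₘ : ∀ {n} → MCtx n → Fin n → MTy n
lookupTyₘ (Γ ▸ₘ A) zero    = wkᵐT A
lookupTyₘ (Γ ▸ₘ A) (suc i) = wkᵐT (lookupTyₘ Γ i)

-- ↓ : reading CaTT syntax in MCaTT, with the base type ⋆ read as 𝟙
-- (so 0-dimensional variables of a ps-context become variables of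
-- type 𝟙, and 1-dimensional ones get type Hom_𝟙 x y = ⋆ₘ up to η).
mutual
  ↓T : ∀ {n} → CTy n → MTy n
  ↓T ⋆           = 𝟙
  ↓T (Hom A t u) = Homᵐ (↓T A) (↓t t) (↓t u)

  ↓t : ∀ {n} → CTm n → MTm n
  ↓t (var i)     = mvar i
  ↓t (op Θ A σ)  = mop Θ A (↓s σ)
  ↓t (coh Θ A σ) = mcoh Θ A (↓s σ)

  ↓s : ∀ {n k} → CSub n k → MSub n k
  ↓s ⟨⟩      = ⟨⟩ₘ
  ↓s (σ ,ᶜ t) = ↓s σ ,ₘ ↓t t

↓C : ∀ {n} → CCtx n → MCtx n
↓C ∅       = ∅ₘ
↓C (Γ ▸ A) = ↓C Γ ▸ₘ ↓T A

mutual
  data _⊢ᵐ : ∀ {n} → MCtx n → Set where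
    ∅ᵐ : ∅ₘ ⊢ᵐ
    ▸ᵐ : ∀ {n} {Γ : MCtx n} {A} → Γ ⊢ᵐ A → (Γ ▸ₘ A) ⊢ᵐ

  data _⊢ᵐ_ {n} (Γ : MCtx n) : MTy n → Set where
    𝟙ᵐ   : Γ ⊢ᵐ → Γ ⊢ᵐ 𝟙
    Homᵐᵗ : ∀ {A t u} → Γ ⊢ᵐ t ∶ A → Γ ⊢ᵐ u ∶ A → Γ ⊢ᵐ Homᵐ A t u

  data _⊢ᵐ_∶_ {n} (Γ : MCtx n) : MTm n → MTy n → Set where
    varᵐ  : ∀ {i A} → Γ ⊢ᵐ → lookupTyₘ Γ i ≡ A → Γ ⊢ᵐ mvar i ∶ A
    unitᵐ : Γ ⊢ᵐ → Γ ⊢ᵐ unit ∶ 𝟙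
    mopᵐ  : ∀ {k} {Θ : CCtx k} {A γ B} → OpCond Θ A →
            Γ ⊢ᵐ γ ∶ˢ ↓C Θ → (↓T A) [ γ ]ᵐT ≡ B → Γ ⊢ᵐ mop Θ A γ ∶ B
    mcohᵐ : ∀ {k} {Θ : CCtx k} {A γ B} → CohCond Θ A →
            Γ ⊢ᵐ γ ∶ˢ ↓C Θ → (↓T A) [ γ ]ᵐT ≡ B → Γ ⊢ᵐ mcoh Θ A γ ∶ B
    convᵐ : ∀ {t A B} → Γ ⊢ᵐ t ∶ A → Γ ⊢ᵐ A ≐ B → Γ ⊢ᵐ t ∶ B

  data _⊢ᵐ_∶ˢ_ {m} (Δ : MCtx m) : ∀ {k} → MSub m k → MCtx k → Set where
    ⟨⟩ᵐ : Δ ⊢ᵐ → Δ ⊢ᵐ ⟨⟩ₘ ∶ˢ ∅ₘ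
    extᵐ : ∀ {k} {Γ : MCtx k} {σ A t} → Δ ⊢ᵐ σ ∶ˢ Γ → Γ ⊢ᵐ A →
          Δ ⊢ᵐ t ∶ (A [ σ ]ᵐT) → Δ ⊢ᵐ (σ ,ₘ t) ∶ˢ (Γ ▸ₘ A)

  data _⊢ᵐ_≐_ {n} (Γ : MCtx n) : MTy n → MTy n → Set where
    reflᵀ  : ∀ {A} → Γ ⊢ᵐ A → Γ ⊢ᵐ A ≐ A
    symᵀ   : ∀ {A B} → Γ ⊢ᵐ A ≐ B → Γ ⊢ᵐ B ≐ A
    transᵀ : ∀ {A B C} → Γ ⊢ᵐ A ≐ B → Γ ⊢ᵐ B ≐ C → Γ ⊢ᵐ A ≐ C
    Homᵀ   : ∀ {A A' t t' u u'} → Γ ⊢ᵐ A ≐ A' → Γ ⊢ᵐ t ≐ t' ∶ A →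
             Γ ⊢ᵐ u ≐ u' ∶ A → Γ ⊢ᵐ Homᵐ A t u ≐ Homᵐ A' t' u'

  data _⊢ᵐ_≐_∶_ {n} (Γ : MCtx n) : MTm n → MTm n → MTy n → Set where
    reflᵗ  : ∀ {t A} → Γ ⊢ᵐ t ∶ A → Γ ⊢ᵐ t ≐ t ∶ A
    symᵗ   : ∀ {t u A} → Γ ⊢ᵐ t ≐ u ∶ A → Γ ⊢ᵐ u ≐ t ∶ A
    transᵗ : ∀ {t u v A} → Γ ⊢ᵐ t ≐ u ∶ A → Γ ⊢ᵐ u ≐ v ∶ A →
             Γ ⊢ᵐ t ≐ v ∶ A
    ηᵗ     : ∀ {t} → Γ ⊢ᵐ t ∶ 𝟙 → Γ ⊢ᵐ t ≐ unit ∶ 𝟙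
    mopᵗ   : ∀ {k} {Θ : CCtx k} {A γ δ B} → OpCond Θ A →
             Γ ⊢ᵐ γ ≐ δ ∶ˢ ↓C Θ → (↓T A) [ γ ]ᵐT ≡ B →
             Γ ⊢ᵐ mop Θ A γ ≐ mop Θ A δ ∶ B
    mcohᵗ  : ∀ {k} {Θ : CCtx k} {A γ δ B} → CohCond Θ A →
             Γ ⊢ᵐ γ ≐ δ ∶ˢ ↓C Θ → (↓T A) [ γ ]ᵐT ≡ B →
             Γ ⊢ᵐ mcoh Θ A γ ≐ mcoh Θ A δ ∶ B
    convᵗ  : ∀ {t u A B} → Γ ⊢ᵐ t ≐ u ∶ A → Γ ⊢ᵐ A ≐ B →
             Γ ⊢ᵐ t ≐ u ∶ B

  data _⊢ᵐ_≐_∶ˢ_ {m} (Δ : MCtx m) : ∀ {k} → MSub m k → MSub m k → MCtx k → Set where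
    ⟨⟩ˢ : Δ ⊢ᵐ → Δ ⊢ᵐ ⟨⟩ₘ ≐ ⟨⟩ₘ ∶ˢ ∅ₘ
    extˢ : ∀ {k} {Γ : MCtx k} {σ τ A t u} → Δ ⊢ᵐ σ ≐ τ ∶ˢ Γ → Γ ⊢ᵐ A →
          Δ ⊢ᵐ t ≐ u ∶ (A [ σ ]ᵐT) → Δ ⊢ᵐ (σ ,ₘ t) ≐ (τ ,ₘ u) ∶ˢ (Γ ▸ₘ A)

-- length of Σr Γ : one fresh variable • plus the non-𝟙 variables
szΣ : ∀ {n} → MCtx n → ℕ
szΣ ∅ₘ                  = 1
szΣ (Γ ▸ₘ 𝟙)            = szΣ Γ
szΣ (Γ ▸ₘ Homᵐ _ _ _)   = suc (szΣ Γ)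

•idx : ∀ {n} (Γ : MCtx n) → Fin (szΣ Γ)
•idx ∅ₘ                 = zero
•idx (Γ ▸ₘ 𝟙)           = •idx Γ
•idx (Γ ▸ₘ Homᵐ _ _ _)  = suc (•idx Γ)

ΣrVar : ∀ {n} (Γ : MCtx n) → Fin n → Fin (szΣ Γ)
ΣrVar (Γ ▸ₘ 𝟙) zero                = •idx Γ
ΣrVar (Γ ▸ₘ 𝟙) (suc i)             = ΣrVar Γ i
ΣrVar (Γ ▸ₘ Homᵐ _ _ _) zero       = zero
ΣrVar (Γ ▸ₘ Homᵐ _ _ _) (suc i)    = suc (ΣrVar Γ i)

-- •_Θ : Σr(↓Θ) → Θ, sending the 0-dimensional variables of Θ to •
•sub : ∀ {k} (Θ : CCtx k) → CSub (szΣ (↓C Θ)) k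
•sub Θ = tabᶜ (λ v → var (ΣrVar (↓C Θ) v))

mutual
  ΣrTy : ∀ {n} (Γ : MCtx n) → MTy n → CTy (szΣ Γ)
  ΣrTy Γ 𝟙            = ⋆
  ΣrTy Γ (Homᵐ A t u) = Hom (ΣrTy Γ A) (ΣrTm Γ t) (ΣrTm Γ u)

  ΣrTm : ∀ {n} (Γ : MCtx n) → MTm n → CTm (szΣ Γ)
  ΣrTm Γ (mvar i)     = var (ΣrVar Γ i)
  ΣrTm Γ unit         = var (•idx Γ)
  ΣrTm Γ (mop Θ A γ)  = op Θ A (•sub Θ ∘ᶜ ΣrSub Γ (↓C Θ) γ)
  ΣrTm Γ (mcoh Θ A γ) = coh Θ A (•sub Θ ∘ᶜ ΣrSub Γ (↓C Θ) γ)

  ΣrSub : ∀ {m n} (Δ : MCtx m) (Γ : MCtx n) → MSub m n →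
          CSub (szΣ Δ) (szΣ Γ)
  ΣrSub Δ ∅ₘ ⟨⟩ₘ                          = ⟨⟩ ,ᶜ var (•idx Δ)
  ΣrSub Δ (Γ ▸ₘ 𝟙) (γ ,ₘ t)               = ΣrSub Δ Γ γ
  ΣrSub Δ (Γ ▸ₘ Homᵐ _ _ _) (γ ,ₘ t)      = ΣrSub Δ Γ γ ,ᶜ ΣrTm Δ t

ΣrCtx : ∀ {n} (Γ : MCtx n) → CCtx (szΣ Γ)
ΣrCtx ∅ₘ                   = ∅ ▸ ⋆
ΣrCtx (Γ ▸ₘ 𝟙)             = ΣrCtx Γ
ΣrCtx (Γ ▸ₘ Homᵐ A t u)    = ΣrCtx Γ ▸ ΣrTy Γ (Homᵐ A t u)

--        top
--    P -------> X
--    |          |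
--  left       right
--    v          v
--    Y -------> Z
--       bottom
IsPullback : ∀ {P X Y Z : Set} → (P → X) → (P → Y) → (X → Z) → (Y → Z) → Set
IsPullback {P} top left right bottom =
  (∀ c → right (top c) ≡ bottom (left c)) ×
  (∀ x y → right x ≡ bottom y → Σ P (λ c → (top c ≡ x) × (left c ≡ y))) ×
  (∀ c c' → top c ≡ top c' → left c ≡ left c' → c ≡ c')

-- Models of CaTT: functors Syn(CaTT) → Set preserving the terminal
-- object (the empty context) and pullbacks along display maps.

record Model : Set₁ where
  field
    Ob      : ∀ {n} → CCtx n → Set
    act     : ∀ {m n} {Δ : CCtx m} {Γ : CCtx n} {σ : CSub m n} →
              Δ ⊢ᶜ σ ∶ˢ Γ → Ob Δ → Ob Γ
    act-irr : ∀ {m n} {Δ : CCtx m} {Γ : CCtx n} {σ : CSub m n}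
              (d d' : Δ ⊢ᶜ σ ∶ˢ Γ) (x : Ob Δ) → act d x ≡ act d' x
    act-id  : ∀ {n} {Γ : CCtx n} (d : Γ ⊢ᶜ idᶜ ∶ˢ Γ) (x : Ob Γ) → act d x ≡ x
    act-∘   : ∀ {m n k} {Δ : CCtx m} {Γ : CCtx n} {Θ : CCtx k}
              {σ : CSub m n} {τ : CSub n k}
              (dσ : Δ ⊢ᶜ σ ∶ˢ Γ) (dτ : Γ ⊢ᶜ τ ∶ˢ Θ) (d : Δ ⊢ᶜ τ ∘ᶜ σ ∶ˢ Θ)
              (x : Ob Δ) → act d x ≡ act dτ (act dσ x)
    terminal : Σ (Ob ∅) (λ c → ∀ x → x ≡ c)
    -- preservation of the pullback of the display map (Γ,x:A) → Γ along σ
    pullback : ∀ {m n} {Δ : CCtx m} {Γ : CCtx n} {A : CTy n} {σ : CSub m n}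
               (dA : Γ ⊢ᶜ A) (dσ : Δ ⊢ᶜ σ ∶ˢ Γ)
               (dq : (Δ ▸ A [ σ ]ᶜT) ⊢ᶜ ((σ ∘ᶜ pᶜ) ,ᶜ var zero) ∶ˢ (Γ ▸ A))
               (dl : (Δ ▸ A [ σ ]ᶜT) ⊢ᶜ pᶜ ∶ˢ Δ)
               (dr : (Γ ▸ A) ⊢ᶜ pᶜ ∶ˢ Γ) →
               IsPullback (act dq) (act dl) (act dr) (act dσ)

-- F ∘ Σr preserves the pullbacks along display maps of Syn(MCaTT):
-- for Γ ⊢ A and Δ ⊢ σ : Γ in MCaTT, the image under Σr of the canonical
-- pullback square
--      (Δ , x : A[σ]) --(σ∘p , x)--> (Γ , x : A)
--            | p                         | p
--            Δ ---------- σ -----------> Γ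
-- consists of well-typed CaTT substitutions and F sends it to a
-- pullback square of sets.

FΣrPreservesDisplayPullbacks : Model → Set
FΣrPreservesDisplayPullbacks F =
  ∀ {m n} {Δ : MCtx m} {Γ : MCtx n} {A : MTy n} {σ : MSub m n} →
  Γ ⊢ᵐ A → Δ ⊢ᵐ σ ∶ˢ Γ →
  Σ (ΣrCtx (Δ ▸ₘ A [ σ ]ᵐT) ⊢ᶜ ΣrSub (Δ ▸ₘ A [ σ ]ᵐT) (Γ ▸ₘ A) ((σ ∘ₘ pₘ) ,ₘ mvar zero) ∶ˢ ΣrCtx (Γ ▸ₘ A)) λ dq →
  Σ (ΣrCtx (Δ ▸ₘ A [ σ ]ᵐT) ⊢ᶜ ΣrSub (Δ ▸ₘ A [ σ ]ᵐT) Δ pₘ ∶ˢ ΣrCtx Δ) λ dl →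
  Σ (ΣrCtx (Γ ▸ₘ A) ⊢ᶜ ΣrSub (Γ ▸ₘ A) Γ pₘ ∶ˢ ΣrCtx Γ) λ dr →
  Σ (ΣrCtx Δ ⊢ᶜ ΣrSub Δ Γ σ ∶ˢ ΣrCtx Γ) λ db →
  IsPullback (Model.act F dq) (Model.act F dl) (Model.act F dr) (Model.act F db)

{-# OPTIONS --safe #-}
-- Along a display map (Γ , x : A) → Γ with A ≠ 𝟙, Σr produces the CaTT display
-- map along Σr A and sends the canonical MCaTT pullback square to the canonical
-- CaTT one, which F preserves by assumption.  Along A = 𝟙 both display maps
-- become identities, and a square with identity sides is always a pullback.
-- The real work is that Σr preserves typing: the η-rule is respected because
-- every term of type 𝟙 is sent to •, and the side conditions of mop and mcoh
-- transfer because Σr (↓ A) = A [ •_Θ ] for every well-formed type A in Θ.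
module Submission where

open import Defs
open import Data.Nat using (zero; suc)
open import Data.Fin using (Fin; zero; suc)
open import Data.Product using (Σ; _×_; _,_; proj₁; proj₂)
open import Relation.Binary.PropositionalEquality
open ≡-Reasoning

cong₃ : ∀ {A B C D : Set} (f : A → B → C → D) {a a' b b' c c'} →
        a ≡ a' → b ≡ b' → c ≡ c' → f a b c ≡ f a' b' c'
cong₃ f refl refl refl = refl

lookup∘tabᶜ : ∀ {m n} (f : Fin n → CTm m) i → lookupᶜ (tabᶜ f) i ≡ f i
lookup∘tabᶜ f zero    = refl
lookup∘tabᶜ f (suc i) = lookup∘tabᶜ (λ j → f (suc j)) i

tab∘lookupᶜ : ∀ {m n} (σ : CSub m n) → tabᶜ (lookupᶜ σ) ≡ σ
tab∘lookupᶜ ⟨⟩       = refl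
tab∘lookupᶜ (σ ,ᶜ t) = cong (_,ᶜ t) (tab∘lookupᶜ σ)

tab-congᶜ : ∀ {m n} {f g : Fin n → CTm m} → (∀ i → f i ≡ g i) → tabᶜ f ≡ tabᶜ g
tab-congᶜ {n = zero}  f≗g = refl
tab-congᶜ {n = suc n} f≗g = cong₂ _,ᶜ_ (tab-congᶜ (λ i → f≗g (suc i))) (f≗g zero)

tab-∘ᶜ : ∀ {m n k} (f : Fin k → CTm n) (σ : CSub m n) →
         tabᶜ f ∘ᶜ σ ≡ tabᶜ (λ i → f i [ σ ]ᶜt)
tab-∘ᶜ {k = zero}  f σ = refl
tab-∘ᶜ {k = suc k} f σ = cong (_,ᶜ (f zero [ σ ]ᶜt)) (tab-∘ᶜ (λ i → f (suc i)) σ)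

lookup-∘ᶜ : ∀ {m n k} (τ : CSub n k) (σ : CSub m n) i →
            lookupᶜ (τ ∘ᶜ σ) i ≡ lookupᶜ τ i [ σ ]ᶜt
lookup-∘ᶜ (τ ,ᶜ t) σ zero    = refl
lookup-∘ᶜ (τ ,ᶜ t) σ (suc i) = lookup-∘ᶜ τ σ i

mutual
  [∘]ᶜT : ∀ {m n k} (A : CTy k) (τ : CSub n k) (σ : CSub m n) →
          A [ τ ∘ᶜ σ ]ᶜT ≡ A [ τ ]ᶜT [ σ ]ᶜT
  [∘]ᶜT ⋆           τ σ = refl
  [∘]ᶜT (Hom A t u) τ σ = cong₃ Hom ([∘]ᶜT A τ σ) ([∘]ᶜt t τ σ) ([∘]ᶜt u τ σ)

  [∘]ᶜt : ∀ {m n k} (t : CTm k) (τ : CSub n k) (σ : CSub m n) →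
          t [ τ ∘ᶜ σ ]ᶜt ≡ t [ τ ]ᶜt [ σ ]ᶜt
  [∘]ᶜt (var i)     τ σ = lookup-∘ᶜ τ σ i
  [∘]ᶜt (op Θ A ρ)  τ σ = cong (op Θ A) (∘ᶜ-assoc ρ τ σ)
  [∘]ᶜt (coh Θ A ρ) τ σ = cong (coh Θ A) (∘ᶜ-assoc ρ τ σ)

  ∘ᶜ-assoc : ∀ {m n k j} (ρ : CSub k j) (τ : CSub n k) (σ : CSub m n) →
             ρ ∘ᶜ (τ ∘ᶜ σ) ≡ (ρ ∘ᶜ τ) ∘ᶜ σ
  ∘ᶜ-assoc ⟨⟩       τ σ = refl
  ∘ᶜ-assoc (ρ ,ᶜ t) τ σ = cong₂ _,ᶜ_ (∘ᶜ-assoc ρ τ σ) ([∘]ᶜt t τ σ)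

mutual
  [id]ᶜT : ∀ {n} (A : CTy n) → A [ idᶜ ]ᶜT ≡ A
  [id]ᶜT ⋆           = refl
  [id]ᶜT (Hom A t u) = cong₃ Hom ([id]ᶜT A) ([id]ᶜt t) ([id]ᶜt u)

  [id]ᶜt : ∀ {n} (t : CTm n) → t [ idᶜ ]ᶜt ≡ t
  [id]ᶜt (var i)     = lookup∘tabᶜ var i
  [id]ᶜt (op Θ A ρ)  = cong (op Θ A) (∘ᶜ-identityʳ ρ)
  [id]ᶜt (coh Θ A ρ) = cong (coh Θ A) (∘ᶜ-identityʳ ρ)

  ∘ᶜ-identityʳ : ∀ {n k} (ρ : CSub n k) → ρ ∘ᶜ idᶜ ≡ ρ
  ∘ᶜ-identityʳ ⟨⟩       = refl
  ∘ᶜ-identityʳ (ρ ,ᶜ t) = cong₂ _,ᶜ_ (∘ᶜ-identityʳ ρ) ([id]ᶜt t)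

∘ᶜ-identityˡ : ∀ {m n} (σ : CSub m n) → idᶜ ∘ᶜ σ ≡ σ
∘ᶜ-identityˡ σ = trans (tab-∘ᶜ var σ) (tab∘lookupᶜ σ)

p∘extᶜ : ∀ {m n} (σ : CSub m n) (t : CTm m) → pᶜ ∘ᶜ (σ ,ᶜ t) ≡ σ
p∘extᶜ σ t = trans (tab-∘ᶜ (λ i → var (suc i)) (σ ,ᶜ t)) (tab∘lookupᶜ σ)

p∘pᶜ : ∀ {n} → pᶜ {n} ∘ᶜ pᶜ ≡ tabᶜ (λ i → var (suc (suc i)))
p∘pᶜ = trans (tab-∘ᶜ (λ i → var (suc i)) pᶜ)
             (tab-congᶜ (λ i → lookup∘tabᶜ (λ j → var (suc j)) (suc i)))

lookup∘tabₘ : ∀ {m n} (f : Fin n → MTm m) i → lookupₘ (tabₘ f) i ≡ f i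
lookup∘tabₘ f zero    = refl
lookup∘tabₘ f (suc i) = lookup∘tabₘ (λ j → f (suc j)) i

tab∘lookupₘ : ∀ {m n} (σ : MSub m n) → tabₘ (lookupₘ σ) ≡ σ
tab∘lookupₘ ⟨⟩ₘ      = refl
tab∘lookupₘ (σ ,ₘ t) = cong (_,ₘ t) (tab∘lookupₘ σ)

tab-∘ₘ : ∀ {m n k} (f : Fin k → MTm n) (σ : MSub m n) →
         tabₘ f ∘ₘ σ ≡ tabₘ (λ i → f i [ σ ]ᵐt)
tab-∘ₘ {k = zero}  f σ = refl
tab-∘ₘ {k = suc k} f σ = cong (_,ₘ (f zero [ σ ]ᵐt)) (tab-∘ₘ (λ i → f (suc i)) σ)

idₘ : ∀ {n} → MSub n n
idₘ = tabₘ mvar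

∘ₘ-identityˡ : ∀ {m n} (σ : MSub m n) → idₘ ∘ₘ σ ≡ σ
∘ₘ-identityˡ σ = trans (tab-∘ₘ mvar σ) (tab∘lookupₘ σ)

↓-lookup : ∀ {m n} (σ : CSub m n) i → ↓t (lookupᶜ σ i) ≡ lookupₘ (↓s σ) i
↓-lookup (σ ,ᶜ t) zero    = refl
↓-lookup (σ ,ᶜ t) (suc i) = ↓-lookup σ i

mutual
  ↓T-[] : ∀ {m n} (A : CTy n) (σ : CSub m n) → ↓T (A [ σ ]ᶜT) ≡ ↓T A [ ↓s σ ]ᵐT
  ↓T-[] ⋆           σ = refl
  ↓T-[] (Hom A t u) σ = cong₃ Homᵐ (↓T-[] A σ) (↓t-[] t σ) (↓t-[] u σ)

  ↓t-[] : ∀ {m n} (t : CTm n) (σ : CSub m n) → ↓t (t [ σ ]ᶜt) ≡ ↓t t [ ↓s σ ]ᵐt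
  ↓t-[] (var i)     σ = ↓-lookup σ i
  ↓t-[] (op Θ A τ)  σ = cong (mop Θ A) (↓s-∘ τ σ)
  ↓t-[] (coh Θ A τ) σ = cong (mcoh Θ A) (↓s-∘ τ σ)

  ↓s-∘ : ∀ {m n k} (τ : CSub n k) (σ : CSub m n) → ↓s (τ ∘ᶜ σ) ≡ ↓s τ ∘ₘ ↓s σ
  ↓s-∘ ⟨⟩       σ = refl
  ↓s-∘ (τ ,ᶜ t) σ = cong₂ _,ₘ_ (↓s-∘ τ σ) (↓t-[] t σ)

↓s-tab : ∀ {m n} (f : Fin n → CTm m) → ↓s (tabᶜ f) ≡ tabₘ (λ i → ↓t (f i))
↓s-tab {n = zero}  f = refl
↓s-tab {n = suc n} f = cong (_,ₘ ↓t (f zero)) (↓s-tab (λ i → f (suc i)))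

↓s-p : ∀ {n} → ↓s (pᶜ {n}) ≡ pₘ
↓s-p = ↓s-tab (λ i → var (suc i))

↓T-wk : ∀ {n} (A : CTy n) → ↓T (wkᶜT A) ≡ wkᵐT (↓T A)
↓T-wk A = trans (↓T-[] A pᶜ) (cong (↓T A [_]ᵐT) ↓s-p)

-- ΣrSub drops the components of σ at type 𝟙, so Σr (t [ σ ]) = Σr t [ Σr σ ]
-- needs those components to be sent to •: true for well-typed σ (η-rule), false
-- for raw ones.  IsΣrOf Δ Γ σ ρ says that ρ is an image of σ in this sense.
record IsΣrOf {m n} (Δ : MCtx m) (Γ : MCtx n) (σ : MSub m n)
              (ρ : CSub (szΣ Δ) (szΣ Γ)) : Set where
  constructor isΣrOf
  field
    on-var : ∀ i → ΣrTm Δ (lookupₘ σ i) ≡ lookupᶜ ρ (ΣrVar Γ i)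
    on-•   : lookupᶜ ρ (•idx Γ) ≡ var (•idx Δ)

•∘Σr : ∀ {n k} (Γ : MCtx n) (Θ : CCtx k) → MSub n k → CSub (szΣ Γ) k
•∘Σr Γ Θ γ = •sub Θ ∘ᶜ ΣrSub Γ (↓C Θ) γ

module _ {m n} {Δ : MCtx m} {Γ : MCtx n} {σ : MSub m n} {ρ : CSub (szΣ Δ) (szΣ Γ)}
         (ρ-σ : IsΣrOf Δ Γ σ ρ) where
  open IsΣrOf ρ-σ

  mutual
    Σr-[]T : (A : MTy n) → ΣrTy Δ (A [ σ ]ᵐT) ≡ ΣrTy Γ A [ ρ ]ᶜT
    Σr-[]T 𝟙            = refl
    Σr-[]T (Homᵐ A t u) = cong₃ Hom (Σr-[]T A) (Σr-[]t t) (Σr-[]t u)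

    Σr-[]t : (t : MTm n) → ΣrTm Δ (t [ σ ]ᵐt) ≡ ΣrTm Γ t [ ρ ]ᶜt
    Σr-[]t (mvar i)     = on-var i
    Σr-[]t unit         = sym on-•
    Σr-[]t (mop Θ A τ)  = cong (op Θ A) (•∘Σr-∘ Θ τ)
    Σr-[]t (mcoh Θ A τ) = cong (coh Θ A) (•∘Σr-∘ Θ τ)

    •∘Σr-∘ : ∀ {k} (Θ : CCtx k) (τ : MSub n k) → •∘Σr Δ Θ (τ ∘ₘ σ) ≡ •∘Σr Γ Θ τ ∘ᶜ ρ
    •∘Σr-∘ Θ τ = trans (cong (•sub Θ ∘ᶜ_) (ΣrSub-∘ (↓C Θ) τ)) (∘ᶜ-assoc (•sub Θ) _ ρ)

    ΣrSub-∘ : ∀ {k} (Θ : MCtx k) (τ : MSub n k) → ΣrSub Δ Θ (τ ∘ₘ σ) ≡ ΣrSub Γ Θ τ ∘ᶜ ρ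
    ΣrSub-∘ ∅ₘ                ⟨⟩ₘ      = cong (⟨⟩ ,ᶜ_) (sym on-•)
    ΣrSub-∘ (Θ ▸ₘ 𝟙)          (τ ,ₘ t) = ΣrSub-∘ Θ τ
    ΣrSub-∘ (Θ ▸ₘ Homᵐ _ _ _) (τ ,ₘ t) = cong₂ _,ᶜ_ (ΣrSub-∘ Θ τ) (Σr-[]t t)

ΣrDisplay : ∀ {n} (Δ : MCtx n) (B : MTy n) → CSub (szΣ (Δ ▸ₘ B)) (szΣ Δ)
ΣrDisplay Δ 𝟙            = idᶜ
ΣrDisplay Δ (Homᵐ _ _ _) = pᶜ

display-isΣrOf : ∀ {n} (Δ : MCtx n) (B : MTy n) → IsΣrOf (Δ ▸ₘ B) Δ pₘ (ΣrDisplay Δ B)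
display-isΣrOf Δ 𝟙 = isΣrOf
  (λ i → trans (cong (ΣrTm (Δ ▸ₘ 𝟙)) (lookup∘tabₘ (λ j → mvar (suc j)) i))
               (sym (lookup∘tabᶜ var (ΣrVar Δ i))))
  (lookup∘tabᶜ var (•idx Δ))
display-isΣrOf Δ B@(Homᵐ _ _ _) = isΣrOf
  (λ i → trans (cong (ΣrTm (Δ ▸ₘ B)) (lookup∘tabₘ (λ j → mvar (suc j)) i))
               (sym (lookup∘tabᶜ (λ j → var (suc j)) (ΣrVar Δ i))))
  (lookup∘tabᶜ (λ j → var (suc j)) (•idx Δ))

ΣrSub-∘p : ∀ {m n} (Δ : MCtx m) (B : MTy m) (Γ : MCtx n) (σ : MSub m n) →
           ΣrSub (Δ ▸ₘ B) Γ (σ ∘ₘ pₘ) ≡ ΣrSub Δ Γ σ ∘ᶜ ΣrDisplay Δ B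
ΣrSub-∘p Δ B = ΣrSub-∘ (display-isΣrOf Δ B)

mutual
  ΣrSub-id : ∀ {n} (Δ : MCtx n) → ΣrSub Δ Δ idₘ ≡ idᶜ
  ΣrSub-id ∅ₘ                  = refl
  ΣrSub-id (Δ ▸ₘ 𝟙)            = ΣrSub-p Δ 𝟙
  ΣrSub-id (Δ ▸ₘ B@(Homᵐ _ _ _)) = cong (_,ᶜ var zero) (ΣrSub-p Δ B)

  ΣrSub-p : ∀ {n} (Δ : MCtx n) (B : MTy n) → ΣrSub (Δ ▸ₘ B) Δ pₘ ≡ ΣrDisplay Δ B
  ΣrSub-p Δ B = begin
    ΣrSub (Δ ▸ₘ B) Δ pₘ             ≡⟨ cong (ΣrSub (Δ ▸ₘ B) Δ) (sym (∘ₘ-identityˡ pₘ)) ⟩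
    ΣrSub (Δ ▸ₘ B) Δ (idₘ ∘ₘ pₘ)    ≡⟨ ΣrSub-∘p Δ B Δ idₘ ⟩
    ΣrSub Δ Δ idₘ ∘ᶜ ΣrDisplay Δ B  ≡⟨ cong (_∘ᶜ ΣrDisplay Δ B) (ΣrSub-id Δ) ⟩
    idᶜ ∘ᶜ ΣrDisplay Δ B            ≡⟨ ∘ᶜ-identityˡ (ΣrDisplay Δ B) ⟩
    ΣrDisplay Δ B                   ∎

ΣrSub-• : ∀ {m n} (Δ : MCtx m) (Γ : MCtx n) (σ : MSub m n) →
          lookupᶜ (ΣrSub Δ Γ σ) (•idx Γ) ≡ var (•idx Δ)
ΣrSub-• Δ ∅ₘ                ⟨⟩ₘ      = refl
ΣrSub-• Δ (Γ ▸ₘ 𝟙)          (σ ,ₘ t) = ΣrSub-• Δ Γ σ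
ΣrSub-• Δ (Γ ▸ₘ Homᵐ _ _ _) (σ ,ₘ t) = ΣrSub-• Δ Γ σ

[]ᵐT-reflects-𝟙 : ∀ {m n} (X : MTy n) (σ : MSub m n) → X [ σ ]ᵐT ≡ 𝟙 → X ≡ 𝟙
[]ᵐT-reflects-𝟙 𝟙 σ _ = refl

ΣrVar-𝟙 : ∀ {n} (Γ : MCtx n) i → lookupTyₘ Γ i ≡ 𝟙 → ΣrVar Γ i ≡ •idx Γ
ΣrVar-𝟙 (Γ ▸ₘ 𝟙)          zero    _ = refl
ΣrVar-𝟙 (Γ ▸ₘ 𝟙)          (suc i) e = ΣrVar-𝟙 Γ i ([]ᵐT-reflects-𝟙 _ pₘ e)
ΣrVar-𝟙 (Γ ▸ₘ Homᵐ _ _ _) (suc i) e = cong suc (ΣrVar-𝟙 Γ i ([]ᵐT-reflects-𝟙 _ pₘ e))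

≐-𝟙 : ∀ {n} {Γ : MCtx n} {A B} → Γ ⊢ᵐ A ≐ B → (A ≡ 𝟙 → B ≡ 𝟙) × (B ≡ 𝟙 → A ≡ 𝟙)
≐-𝟙 (reflᵀ _)      = (λ e → e) , (λ e → e)
≐-𝟙 (symᵀ d)       = proj₂ (≐-𝟙 d) , proj₁ (≐-𝟙 d)
≐-𝟙 (transᵀ d d')  = (λ e → proj₁ (≐-𝟙 d') (proj₁ (≐-𝟙 d) e)) ,
                     (λ e → proj₂ (≐-𝟙 d) (proj₂ (≐-𝟙 d') e))
≐-𝟙 (Homᵀ _ _ _)   = (λ ()) , (λ ())

Σr-tm-𝟙 : ∀ {n} {Γ : MCtx n} {t A} → Γ ⊢ᵐ t ∶ A → A ≡ 𝟙 → ΣrTm Γ t ≡ var (•idx Γ)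
Σr-tm-𝟙 {Γ = Γ} (varᵐ {i = i} _ e) e' = cong var (ΣrVar-𝟙 Γ i (trans e e'))
Σr-tm-𝟙 (unitᵐ _) _                  = refl
Σr-tm-𝟙 (mopᵐ (opc _ _ _ _ _ _) _ e) e' with () ← trans e e'
Σr-tm-𝟙 (mcohᵐ (cohc _ _ _ _ _) _ e) e' with () ← trans e e'
Σr-tm-𝟙 (convᵐ d c) e                = Σr-tm-𝟙 d (proj₂ (≐-𝟙 c) e)

⊢s-isΣrOf : ∀ {m n} {Δ : MCtx m} {Γ : MCtx n} {σ} → Δ ⊢ᵐ σ ∶ˢ Γ →
            IsΣrOf Δ Γ σ (ΣrSub Δ Γ σ)
⊢s-isΣrOf {Δ = Δ} {Γ} {σ} dσ = isΣrOf (on-var dσ) (ΣrSub-• Δ Γ σ)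
  where
  on-var : ∀ {k} {Γ : MCtx k} {σ} → Δ ⊢ᵐ σ ∶ˢ Γ →
           ∀ i → ΣrTm Δ (lookupₘ σ i) ≡ lookupᶜ (ΣrSub Δ Γ σ) (ΣrVar Γ i)
  on-var (extᵐ {Γ = Γ} {σ} {𝟙} _ _ dt) zero    = trans (Σr-tm-𝟙 dt refl) (sym (ΣrSub-• Δ Γ σ))
  on-var (extᵐ {A = 𝟙} dσ _ _)          (suc i) = on-var dσ i
  on-var (extᵐ {A = Homᵐ _ _ _} _ _ _)  zero    = refl
  on-var (extᵐ {A = Homᵐ _ _ _} dσ _ _) (suc i) = on-var dσ i

mutual
  Σr-≐T : ∀ {n} {Γ : MCtx n} {A B} → Γ ⊢ᵐ A ≐ B → ΣrTy Γ A ≡ ΣrTy Γ B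
  Σr-≐T (reflᵀ _)     = refl
  Σr-≐T (symᵀ d)      = sym (Σr-≐T d)
  Σr-≐T (transᵀ d d') = trans (Σr-≐T d) (Σr-≐T d')
  Σr-≐T (Homᵀ a b c)  = cong₃ Hom (Σr-≐T a) (Σr-≐t b) (Σr-≐t c)

  Σr-≐t : ∀ {n} {Γ : MCtx n} {t u A} → Γ ⊢ᵐ t ≐ u ∶ A → ΣrTm Γ t ≡ ΣrTm Γ u
  Σr-≐t (reflᵗ _)     = refl
  Σr-≐t (symᵗ d)      = sym (Σr-≐t d)
  Σr-≐t (transᵗ d d') = trans (Σr-≐t d) (Σr-≐t d')
  Σr-≐t (ηᵗ d)        = Σr-tm-𝟙 d refl
  Σr-≐t (mopᵗ {Θ = Θ} {A} _ e _)  = cong (λ s → op Θ A (•sub Θ ∘ᶜ s)) (Σr-≐s e)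
  Σr-≐t (mcohᵗ {Θ = Θ} {A} _ e _) = cong (λ s → coh Θ A (•sub Θ ∘ᶜ s)) (Σr-≐s e)
  Σr-≐t (convᵗ d _)   = Σr-≐t d

  Σr-≐s : ∀ {m k} {Δ : MCtx m} {Θ : MCtx k} {γ δ} → Δ ⊢ᵐ γ ≐ δ ∶ˢ Θ →
          ΣrSub Δ Θ γ ≡ ΣrSub Δ Θ δ
  Σr-≐s (⟨⟩ˢ _)                       = refl
  Σr-≐s (extˢ {A = 𝟙} e _ _)           = Σr-≐s e
  Σr-≐s (extˢ {A = Homᵐ _ _ _} e _ et) = cong₂ _,ᶜ_ (Σr-≐s e) (Σr-≐t et)

⊢s-ctx : ∀ {m k} {Δ : CCtx m} {Θ : CCtx k} {σ} → Δ ⊢ᶜ σ ∶ˢ Θ → Δ ⊢ᶜ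
⊢s-ctx (⟨⟩ᶜ d)      = d
⊢s-ctx (extᶜ d _ _) = ⊢s-ctx d

⊢t-ctx : ∀ {n} {Γ : CCtx n} {t A} → Γ ⊢ᶜ t ∶ A → Γ ⊢ᶜ
⊢t-ctx (varᶜ d _)   = d
⊢t-ctx (opᶜ _ d _)  = ⊢s-ctx d
⊢t-ctx (cohᶜ _ d _) = ⊢s-ctx d

⊢T-ctx : ∀ {n} {Γ : CCtx n} {A} → Γ ⊢ᶜ A → Γ ⊢ᶜ
⊢T-ctx (⋆ᶜ d)     = d
⊢T-ctx (Homᶜ d _) = ⊢t-ctx d

OpCond-ctx : ∀ {k} {Θ : CCtx k} {A} → OpCond Θ A → Θ ⊢ᶜ
OpCond-ctx (opc _ d _ _ _ _) = ⊢t-ctx d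

CohCond-ctx : ∀ {k} {Θ : CCtx k} {A} → CohCond Θ A → Θ ⊢ᶜ
CohCond-ctx (cohc _ d _ _ _) = ⊢t-ctx d

[]ᶜT-reflects-⋆ : ∀ {m n} (X : CTy n) (σ : CSub m n) → X [ σ ]ᶜT ≡ ⋆ → X ≡ ⋆
[]ᶜT-reflects-⋆ ⋆ σ _ = refl

ΣrVar-↓-⋆ : ∀ {n} (Θ : CCtx n) i → lookupTyᶜ Θ i ≡ ⋆ → ΣrVar (↓C Θ) i ≡ •idx (↓C Θ)
ΣrVar-↓-⋆ (Θ ▸ ⋆)         zero    _ = refl
ΣrVar-↓-⋆ (Θ ▸ ⋆)         (suc i) e = ΣrVar-↓-⋆ Θ i ([]ᶜT-reflects-⋆ _ pᶜ e)
ΣrVar-↓-⋆ (Θ ▸ Hom _ _ _) (suc i) e = cong suc (ΣrVar-↓-⋆ Θ i ([]ᶜT-reflects-⋆ _ pᶜ e))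

⊢t⋆-var : ∀ {n} {Θ : CCtx n} {t C} → Θ ⊢ᶜ t ∶ C → C ≡ ⋆ →
          Σ (Fin n) (λ i → (t ≡ var i) × (lookupTyᶜ Θ i ≡ ⋆))
⊢t⋆-var (varᶜ {i = i} _ e) e' = i , refl , trans e e'
⊢t⋆-var (opᶜ (opc _ _ _ _ _ _) _ e) e' with () ← trans e e'
⊢t⋆-var (cohᶜ (cohc _ _ _ _ _) _ e) e' with () ← trans e e'

•sub-⋆ : ∀ {n} {Θ : CCtx n} {t} → Θ ⊢ᶜ t ∶ ⋆ → t [ •sub Θ ]ᶜt ≡ var (•idx (↓C Θ))
•sub-⋆ {Θ = Θ} dt with ⊢t⋆-var dt refl
... | i , refl , e = trans (lookup∘tabᶜ (λ v → var (ΣrVar (↓C Θ) v)) i)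
                           (cong var (ΣrVar-↓-⋆ Θ i e))

Σr↓-⋆ : ∀ {n} {Θ : CCtx n} {t} → Θ ⊢ᶜ t ∶ ⋆ → ΣrTm (↓C Θ) (↓t t) ≡ var (•idx (↓C Θ))
Σr↓-⋆ {Θ = Θ} dt with ⊢t⋆-var dt refl
... | i , refl , e = cong var (ΣrVar-↓-⋆ Θ i e)

↓⊢s-isΣrOf : ∀ {m k} {Θ : CCtx m} {Θ' : CCtx k} {τ} → Θ ⊢ᶜ τ ∶ˢ Θ' →
             IsΣrOf (↓C Θ) (↓C Θ') (↓s τ) (ΣrSub (↓C Θ) (↓C Θ') (↓s τ))
↓⊢s-isΣrOf {Θ = Θ} {Θ'} {τ} dτ = isΣrOf (on-var dτ) (ΣrSub-• (↓C Θ) (↓C Θ') (↓s τ))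
  where
  on-var : ∀ {k} {Θ' : CCtx k} {τ} → Θ ⊢ᶜ τ ∶ˢ Θ' → ∀ i →
           ΣrTm (↓C Θ) (lookupₘ (↓s τ) i)
             ≡ lookupᶜ (ΣrSub (↓C Θ) (↓C Θ') (↓s τ)) (ΣrVar (↓C Θ') i)
  on-var (extᶜ {Γ = Γ} {σ} {⋆} _ _ dt) zero    =
    trans (Σr↓-⋆ dt) (sym (ΣrSub-• (↓C Θ) (↓C Γ) (↓s σ)))
  on-var (extᶜ {A = ⋆} dσ _ _)         (suc i) = on-var dσ i
  on-var (extᶜ {A = Hom _ _ _} _ _ _)  zero    = refl
  on-var (extᶜ {A = Hom _ _ _} dσ _ _) (suc i) = on-var dσ i

ΣrComponent : ∀ {n k} (Γ : MCtx n) → CTy k → MTm n → CTm (szΣ Γ)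
ΣrComponent Γ ⋆           s = var (•idx Γ)
ΣrComponent Γ (Hom _ _ _) s = ΣrTm Γ s

•∘Σr-ext : ∀ {n k} (Γ : MCtx n) (Θ : CCtx k) (C : CTy k) (γ : MSub n k) (s : MTm n) →
           •∘Σr Γ (Θ ▸ C) (γ ,ₘ s) ≡ •∘Σr Γ Θ γ ,ᶜ ΣrComponent Γ C s
•∘Σr-ext Γ Θ ⋆ γ s = cong (•∘Σr Γ Θ γ ,ᶜ_) (ΣrSub-• Γ (↓C Θ) γ)
•∘Σr-ext Γ Θ (Hom A t u) γ s = cong (_,ᶜ ΣrTm Γ s)
  (trans (tab-∘ᶜ (λ i → var (suc (ΣrVar (↓C Θ) i))) (ΣrSub Γ (↓C Θ) γ ,ᶜ ΣrTm Γ s))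
         (sym (tab-∘ᶜ (λ i → var (ΣrVar (↓C Θ) i)) (ΣrSub Γ (↓C Θ) γ))))

Σr↓≡[•] : ∀ {n} → CCtx n → CTy n → Set
Σr↓≡[•] Θ C = ΣrTy (↓C Θ) (↓T C) ≡ C [ •sub Θ ]ᶜT

•sub-∘-display : ∀ {n} (Θ : CCtx n) (E : CTy n) →
                 •sub Θ ∘ᶜ ΣrDisplay (↓C Θ) (↓T E) ≡ pᶜ ∘ᶜ •sub (Θ ▸ E)
•sub-∘-display Θ E = begin
  •sub Θ ∘ᶜ π
    ≡⟨ tab-∘ᶜ (λ i → var (ΣrVar (↓C Θ) i)) π ⟩
  tabᶜ (λ i → lookupᶜ π (ΣrVar (↓C Θ) i))
    ≡⟨ tab-congᶜ (λ i → sym (IsΣrOf.on-var (display-isΣrOf (↓C Θ) (↓T E)) i)) ⟩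
  tabᶜ (λ i → ΣrTm ΘE (lookupₘ pₘ i))
    ≡⟨ tab-congᶜ (λ i → cong (ΣrTm ΘE) (lookup∘tabₘ (λ j → mvar (suc j)) i)) ⟩
  tabᶜ (λ i → var (ΣrVar ΘE (suc i)))
    ≡⟨ tab-congᶜ (λ i → sym (lookup∘tabᶜ (λ v → var (ΣrVar ΘE v)) (suc i))) ⟩
  tabᶜ (λ i → lookupᶜ (•sub (Θ ▸ E)) (suc i))
    ≡⟨ sym (tab-∘ᶜ (λ i → var (suc i)) (•sub (Θ ▸ E))) ⟩
  pᶜ ∘ᶜ •sub (Θ ▸ E) ∎
  where
  π  = ΣrDisplay (↓C Θ) (↓T E)
  ΘE = ↓C (Θ ▸ E)

Σr↓≡[•]-wk : ∀ {n} {Θ : CCtx n} {E C : CTy n} → Σr↓≡[•] Θ C → Σr↓≡[•] (Θ ▸ E) (wkᶜT C)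
Σr↓≡[•]-wk {Θ = Θ} {E} {C} eq = begin
  ΣrTy (↓C Θ ▸ₘ ↓T E) (↓T (C [ pᶜ ]ᶜT))  ≡⟨ cong (ΣrTy (↓C Θ ▸ₘ ↓T E)) (↓T-wk C) ⟩
  ΣrTy (↓C Θ ▸ₘ ↓T E) (↓T C [ pₘ ]ᵐT)     ≡⟨ Σr-[]T (display-isΣrOf (↓C Θ) (↓T E)) (↓T C) ⟩
  ΣrTy (↓C Θ) (↓T C) [ π ]ᶜT              ≡⟨ cong (_[ π ]ᶜT) eq ⟩
  C [ •sub Θ ]ᶜT [ π ]ᶜT                  ≡⟨ sym ([∘]ᶜT C (•sub Θ) π) ⟩
  C [ •sub Θ ∘ᶜ π ]ᶜT                     ≡⟨ cong (C [_]ᶜT) (•sub-∘-display Θ E) ⟩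
  C [ pᶜ ∘ᶜ •sub (Θ ▸ E) ]ᶜT              ≡⟨ [∘]ᶜT C pᶜ (•sub (Θ ▸ E)) ⟩
  C [ pᶜ ]ᶜT [ •sub (Θ ▸ E) ]ᶜT           ∎
  where π = ΣrDisplay (↓C Θ) (↓T E)

-- Σr↓-ctx-ty/tm/sub reach the context derivation inside a judgement
-- structurally; going through ⊢T-ctx would not pass the termination checker.
mutual
  Σr↓-ty : ∀ {n} {Θ : CCtx n} {C} → Θ ⊢ᶜ C → Σr↓≡[•] Θ C
  Σr↓-ty (⋆ᶜ _)       = refl
  Σr↓-ty (Homᶜ dt du) = Σr↓-Hom dt du

  Σr↓-Hom : ∀ {n} {Θ : CCtx n} {A t u} → Θ ⊢ᶜ t ∶ A → Θ ⊢ᶜ u ∶ A → Σr↓≡[•] Θ (Hom A t u)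
  Σr↓-Hom dt du = cong₃ Hom (Σr↓-tyOf dt) (Σr↓-tm dt) (Σr↓-tm du)

  Σr↓-tm : ∀ {n} {Θ : CCtx n} {t C} → Θ ⊢ᶜ t ∶ C → ΣrTm (↓C Θ) (↓t t) ≡ t [ •sub Θ ]ᶜt
  Σr↓-tm {Θ = Θ} (varᶜ {i = i} _ _) = sym (lookup∘tabᶜ (λ v → var (ΣrVar (↓C Θ) v)) i)
  Σr↓-tm (opᶜ {Θ = Θ'} {A} _ dσ _)  = cong (op Θ' A) (Σr↓-sub dσ)
  Σr↓-tm (cohᶜ {Θ = Θ'} {A} _ dσ _) = cong (coh Θ' A) (Σr↓-sub dσ)

  Σr↓-sub : ∀ {m k} {Θ : CCtx m} {Θ' : CCtx k} {τ} → Θ ⊢ᶜ τ ∶ˢ Θ' →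
            •∘Σr (↓C Θ) Θ' (↓s τ) ≡ τ ∘ᶜ •sub Θ
  Σr↓-sub (⟨⟩ᶜ _) = refl
  Σr↓-sub {Θ = Θ} (extᶜ {Γ = Γ} {σ} {⋆} {t} dσ _ dt) =
    trans (•∘Σr-ext (↓C Θ) Γ ⋆ (↓s σ) (↓t t)) (cong₂ _,ᶜ_ (Σr↓-sub dσ) (sym (•sub-⋆ dt)))
  Σr↓-sub {Θ = Θ} (extᶜ {Γ = Γ} {σ} {Hom A u v} {t} dσ _ dt) =
    trans (•∘Σr-ext (↓C Θ) Γ (Hom A u v) (↓s σ) (↓t t)) (cong₂ _,ᶜ_ (Σr↓-sub dσ) (Σr↓-tm dt))

  Σr↓-tyOf : ∀ {n} {Θ : CCtx n} {t C} → Θ ⊢ᶜ t ∶ C → Σr↓≡[•] Θ C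
  Σr↓-tyOf {Θ = Θ} (varᶜ {i = i} d e)       = subst (Σr↓≡[•] Θ) e (Σr↓-ctx d i)
  Σr↓-tyOf {Θ = Θ} (opᶜ {A = A} oc dσ e)    = subst (Σr↓≡[•] Θ) e (Σr↓-[] A dσ (Σr↓-OpCond oc))
  Σr↓-tyOf {Θ = Θ} (cohᶜ {A = A} oc dσ e)   = subst (Σr↓≡[•] Θ) e (Σr↓-[] A dσ (Σr↓-CohCond oc))

  Σr↓-[] : ∀ {n k} {Θ : CCtx n} {Θ' : CCtx k} (A : CTy k) {σ : CSub n k} →
           Θ ⊢ᶜ σ ∶ˢ Θ' → Σr↓≡[•] Θ' A → Σr↓≡[•] Θ (A [ σ ]ᶜT)
  Σr↓-[] {Θ = Θ} {Θ'} A {σ} dσ eq = begin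
    ΣrTy (↓C Θ) (↓T (A [ σ ]ᶜT))  ≡⟨ cong (ΣrTy (↓C Θ)) (↓T-[] A σ) ⟩
    ΣrTy (↓C Θ) (↓T A [ ↓s σ ]ᵐT) ≡⟨ Σr-[]T (↓⊢s-isΣrOf dσ) (↓T A) ⟩
    ΣrTy (↓C Θ') (↓T A) [ ρ ]ᶜT   ≡⟨ cong (_[ ρ ]ᶜT) eq ⟩
    A [ •sub Θ' ]ᶜT [ ρ ]ᶜT       ≡⟨ sym ([∘]ᶜT A (•sub Θ') ρ) ⟩
    A [ •sub Θ' ∘ᶜ ρ ]ᶜT          ≡⟨ cong (A [_]ᶜT) (Σr↓-sub dσ) ⟩
    A [ σ ∘ᶜ •sub Θ ]ᶜT           ≡⟨ [∘]ᶜT A σ (•sub Θ) ⟩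
    A [ σ ]ᶜT [ •sub Θ ]ᶜT        ∎
    where ρ = ΣrSub (↓C Θ) (↓C Θ') (↓s σ)

  Σr↓-OpCond : ∀ {k} {Θ : CCtx k} {A} → OpCond Θ A → Σr↓≡[•] Θ A
  Σr↓-OpCond (opc _ dt du _ _ _) = Σr↓-Hom dt du

  Σr↓-CohCond : ∀ {k} {Θ : CCtx k} {A} → CohCond Θ A → Σr↓≡[•] Θ A
  Σr↓-CohCond (cohc _ dt du _ _) = Σr↓-Hom dt du

  Σr↓-ctx : ∀ {n} {Θ : CCtx n} → Θ ⊢ᶜ → ∀ i → Σr↓≡[•] Θ (lookupTyᶜ Θ i)
  Σr↓-ctx (▸ᶜ dC) zero    = Σr↓≡[•]-wk (Σr↓-ty dC)
  Σr↓-ctx (▸ᶜ dC) (suc i) = Σr↓≡[•]-wk (Σr↓-ctx-ty dC i)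

  Σr↓-ctx-ty : ∀ {n} {Θ : CCtx n} {C} → Θ ⊢ᶜ C → ∀ i → Σr↓≡[•] Θ (lookupTyᶜ Θ i)
  Σr↓-ctx-ty (⋆ᶜ d)      = Σr↓-ctx d
  Σr↓-ctx-ty (Homᶜ dt _) = Σr↓-ctx-tm dt

  Σr↓-ctx-tm : ∀ {n} {Θ : CCtx n} {t C} → Θ ⊢ᶜ t ∶ C → ∀ i → Σr↓≡[•] Θ (lookupTyᶜ Θ i)
  Σr↓-ctx-tm (varᶜ d _)    = Σr↓-ctx d
  Σr↓-ctx-tm (opᶜ _ dσ _)  = Σr↓-ctx-sub dσ
  Σr↓-ctx-tm (cohᶜ _ dσ _) = Σr↓-ctx-sub dσ

  Σr↓-ctx-sub : ∀ {m k} {Θ : CCtx m} {Θ' : CCtx k} {τ} → Θ ⊢ᶜ τ ∶ˢ Θ' →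
                ∀ i → Σr↓≡[•] Θ (lookupTyᶜ Θ i)
  Σr↓-ctx-sub (⟨⟩ᶜ d)       = Σr↓-ctx d
  Σr↓-ctx-sub (extᶜ dσ _ _) = Σr↓-ctx-sub dσ

•-type : ∀ {n} (Γ : MCtx n) → lookupTyᶜ (ΣrCtx Γ) (•idx Γ) ≡ ⋆
•-type ∅ₘ                = refl
•-type (Γ ▸ₘ 𝟙)          = •-type Γ
•-type (Γ ▸ₘ Homᵐ _ _ _) = cong wkᶜT (•-type Γ)

ΣrVar-type : ∀ {n} (Γ : MCtx n) i → lookupTyᶜ (ΣrCtx Γ) (ΣrVar Γ i) ≡ ΣrTy Γ (lookupTyₘ Γ i)
ΣrVar-type (Γ ▸ₘ 𝟙) zero = •-type Γ
ΣrVar-type (Γ ▸ₘ 𝟙) (suc i) =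
  trans (ΣrVar-type Γ i) (sym (trans (Σr-[]T (display-isΣrOf Γ 𝟙) (lookupTyₘ Γ i)) ([id]ᶜT _)))
ΣrVar-type (Γ ▸ₘ B@(Homᵐ _ _ _)) zero = sym (Σr-[]T (display-isΣrOf Γ B) B)
ΣrVar-type (Γ ▸ₘ B@(Homᵐ _ _ _)) (suc i) =
  trans (cong wkᶜT (ΣrVar-type Γ i)) (sym (Σr-[]T (display-isΣrOf Γ B) (lookupTyₘ Γ i)))

•∘Σr-type : ∀ {n k} {Γ : MCtx n} {Θ : CCtx k} (A : CTy k) {γ : MSub n k} →
            Γ ⊢ᵐ γ ∶ˢ ↓C Θ → Σr↓≡[•] Θ A →
            A [ •∘Σr Γ Θ γ ]ᶜT ≡ ΣrTy Γ (↓T A [ γ ]ᵐT)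
•∘Σr-type {Γ = Γ} {Θ} A {γ} dγ eq = sym (begin
  ΣrTy Γ (↓T A [ γ ]ᵐT)          ≡⟨ Σr-[]T (⊢s-isΣrOf dγ) (↓T A) ⟩
  ΣrTy (↓C Θ) (↓T A) [ ρ ]ᶜT     ≡⟨ cong (_[ ρ ]ᶜT) eq ⟩
  A [ •sub Θ ]ᶜT [ ρ ]ᶜT         ≡⟨ sym ([∘]ᶜT A (•sub Θ) ρ) ⟩
  A [ •∘Σr Γ Θ γ ]ᶜT             ∎)
  where ρ = ΣrSub Γ (↓C Θ) γ

mutual
  Σr-⊢C : ∀ {n} {Γ : MCtx n} → Γ ⊢ᵐ → ΣrCtx Γ ⊢ᶜ
  Σr-⊢C ∅ᵐ                          = ▸ᶜ (⋆ᶜ ∅ᶜ)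
  Σr-⊢C (▸ᵐ {A = 𝟙} (𝟙ᵐ d))          = Σr-⊢C d
  Σr-⊢C (▸ᵐ {A = Homᵐ _ _ _} dA)     = ▸ᶜ (Σr-⊢T dA)

  Σr-⊢T : ∀ {n} {Γ : MCtx n} {A} → Γ ⊢ᵐ A → ΣrCtx Γ ⊢ᶜ ΣrTy Γ A
  Σr-⊢T (𝟙ᵐ d)        = ⋆ᶜ (Σr-⊢C d)
  Σr-⊢T (Homᵐᵗ dt du) = Homᶜ (Σr-⊢t dt) (Σr-⊢t du)

  Σr-⊢t : ∀ {n} {Γ : MCtx n} {t A} → Γ ⊢ᵐ t ∶ A → ΣrCtx Γ ⊢ᶜ ΣrTm Γ t ∶ ΣrTy Γ A
  Σr-⊢t {Γ = Γ} (varᵐ {i = i} d e) = varᶜ (Σr-⊢C d) (trans (ΣrVar-type Γ i) (cong (ΣrTy Γ) e))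
  Σr-⊢t {Γ = Γ} (unitᵐ d)          = varᶜ (Σr-⊢C d) (•-type Γ)
  Σr-⊢t {Γ = Γ} (mopᵐ {A = A} oc dγ e) =
    opᶜ oc (•∘Σr-⊢s dγ (OpCond-ctx oc))
      (trans (•∘Σr-type A dγ (Σr↓-OpCond oc)) (cong (ΣrTy Γ) e))
  Σr-⊢t {Γ = Γ} (mcohᵐ {A = A} oc dγ e) =
    cohᶜ oc (•∘Σr-⊢s dγ (CohCond-ctx oc))
      (trans (•∘Σr-type A dγ (Σr↓-CohCond oc)) (cong (ΣrTy Γ) e))
  Σr-⊢t {Γ = Γ} {t} (convᵐ d c) = subst (ΣrCtx Γ ⊢ᶜ ΣrTm Γ t ∶_) (Σr-≐T c) (Σr-⊢t d)

  Σr-⊢s : ∀ {m n} {Δ : MCtx m} {Γ : MCtx n} {σ} → Δ ⊢ᵐ σ ∶ˢ Γ →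
          ΣrCtx Δ ⊢ᶜ ΣrSub Δ Γ σ ∶ˢ ΣrCtx Γ
  Σr-⊢s {Δ = Δ} (⟨⟩ᵐ d)         = extᶜ (⟨⟩ᶜ (Σr-⊢C d)) (⋆ᶜ ∅ᶜ) (varᶜ (Σr-⊢C d) (•-type Δ))
  Σr-⊢s (extᵐ {A = 𝟙} dσ _ _)    = Σr-⊢s dσ
  Σr-⊢s {Δ = Δ} (extᵐ {A = B@(Homᵐ _ _ _)} {t} dσ dB dt) =
    extᶜ (Σr-⊢s dσ) (Σr-⊢T dB)
      (subst (ΣrCtx Δ ⊢ᶜ ΣrTm Δ t ∶_) (Σr-[]T (⊢s-isΣrOf dσ) B) (Σr-⊢t dt))

  •∘Σr-⊢s : ∀ {n k} {Γ : MCtx n} {Θ : CCtx k} {γ} → Γ ⊢ᵐ γ ∶ˢ ↓C Θ → Θ ⊢ᶜ →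
            ΣrCtx Γ ⊢ᶜ (•∘Σr Γ Θ γ) ∶ˢ Θ
  •∘Σr-⊢s {Θ = ∅} (⟨⟩ᵐ d) _ = ⟨⟩ᶜ (Σr-⊢C d)
  •∘Σr-⊢s {Γ = Γ} {Θ ▸ ⋆} (extᵐ {σ = γ} {t = s} dγ _ _) (▸ᶜ dC) =
    subst (ΣrCtx Γ ⊢ᶜ_∶ˢ (Θ ▸ ⋆)) (sym (•∘Σr-ext Γ Θ ⋆ γ s))
      (extᶜ dγ' dC (varᶜ (⊢s-ctx dγ') (•-type Γ)))
    where dγ' = •∘Σr-⊢s dγ (⊢T-ctx dC)
  •∘Σr-⊢s {Γ = Γ} {Θ ▸ C@(Hom _ _ _)} (extᵐ {σ = γ} {t = s} dγ _ ds) (▸ᶜ dC) =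
    subst (ΣrCtx Γ ⊢ᶜ_∶ˢ (Θ ▸ C)) (sym (•∘Σr-ext Γ Θ C γ s))
      (extᶜ (•∘Σr-⊢s dγ (⊢T-ctx dC)) dC
        (subst (ΣrCtx Γ ⊢ᶜ ΣrTm Γ s ∶_) (sym (•∘Σr-type C dγ (Σr↓-ty dC))) (Σr-⊢t ds)))

module _ {n} {Γ : CCtx n} {A : CTy n} (dA : Γ ⊢ᶜ A) where
  mutual
    wk-⊢T : ∀ {B} → Γ ⊢ᶜ B → (Γ ▸ A) ⊢ᶜ (B [ pᶜ ]ᶜT)
    wk-⊢T (⋆ᶜ _)       = ⋆ᶜ (▸ᶜ dA)
    wk-⊢T (Homᶜ dt du) = Homᶜ (wk-⊢t dt) (wk-⊢t du)

    wk-⊢t : ∀ {t B} → Γ ⊢ᶜ t ∶ B → (Γ ▸ A) ⊢ᶜ (t [ pᶜ ]ᶜt) ∶ (B [ pᶜ ]ᶜT)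
    wk-⊢t (varᶜ {i = i} _ e) =
      subst ((Γ ▸ A) ⊢ᶜ_∶ _) (sym (lookup∘tabᶜ (λ j → var (suc j)) i))
        (varᶜ (▸ᶜ dA) (cong wkᶜT e))
    wk-⊢t (opᶜ {A = A'} {σ} oc dσ e)  = opᶜ oc (wk-⊢s dσ) (trans ([∘]ᶜT A' σ pᶜ) (cong wkᶜT e))
    wk-⊢t (cohᶜ {A = A'} {σ} oc dσ e) = cohᶜ oc (wk-⊢s dσ) (trans ([∘]ᶜT A' σ pᶜ) (cong wkᶜT e))

    wk-⊢s : ∀ {k} {Θ : CCtx k} {σ} → Γ ⊢ᶜ σ ∶ˢ Θ → (Γ ▸ A) ⊢ᶜ (σ ∘ᶜ pᶜ) ∶ˢ Θ
    wk-⊢s (⟨⟩ᶜ _) = ⟨⟩ᶜ (▸ᶜ dA)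
    wk-⊢s (extᶜ {σ = σ} {A = C} {t} dσ dC dt) =
      extᶜ (wk-⊢s dσ) dC (subst ((Γ ▸ A) ⊢ᶜ (t [ pᶜ ]ᶜt) ∶_) (sym ([∘]ᶜT C σ pᶜ)) (wk-⊢t dt))

p-⊢s : ∀ {n} {Γ : CCtx n} {A} → Γ ⊢ᶜ A → (Γ ▸ A) ⊢ᶜ pᶜ ∶ˢ Γ
p-⊢s dA = go (⊢T-ctx dA) dA
  where
  go : ∀ {n} {Γ : CCtx n} {A} → Γ ⊢ᶜ → Γ ⊢ᶜ A → (Γ ▸ A) ⊢ᶜ pᶜ ∶ˢ Γ
  go ∅ᶜ dA = ⟨⟩ᶜ (▸ᶜ dA)
  go {Γ = Γ ▸ C} {A} (▸ᶜ dC) dA =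
    extᶜ (subst (((Γ ▸ C) ▸ A) ⊢ᶜ_∶ˢ Γ) p∘pᶜ (wk-⊢s dA (go (⊢T-ctx dC) dC))) dC
      (varᶜ (▸ᶜ dA) (trans (sym ([∘]ᶜT C pᶜ pᶜ)) (cong (C [_]ᶜT) p∘pᶜ)))

id-⊢s : ∀ {n} {Γ : CCtx n} → Γ ⊢ᶜ → Γ ⊢ᶜ idᶜ ∶ˢ Γ
id-⊢s ∅ᶜ      = ⟨⟩ᶜ ∅ᶜ
id-⊢s (▸ᶜ dC) = extᶜ (p-⊢s dC) dC (varᶜ (▸ᶜ dC) refl)

lookup-⊢t : ∀ {m n} {Δ : CCtx m} {Γ : CCtx n} {σ} → Δ ⊢ᶜ σ ∶ˢ Γ → ∀ i →
            Δ ⊢ᶜ lookupᶜ σ i ∶ (lookupTyᶜ Γ i [ σ ]ᶜT)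
lookup-⊢t {Δ = Δ} (extᶜ {σ = σ} {A = C} {t} _ _ dt) zero =
  subst (Δ ⊢ᶜ t ∶_) (trans (cong (C [_]ᶜT) (sym (p∘extᶜ σ t))) ([∘]ᶜT C pᶜ (σ ,ᶜ t))) dt
lookup-⊢t {Δ = Δ} {Γ ▸ _} (extᶜ {σ = σ} {t = t} dσ _ _) (suc i) =
  subst (Δ ⊢ᶜ lookupᶜ σ i ∶_)
    (trans (cong (lookupTyᶜ Γ i [_]ᶜT) (sym (p∘extᶜ σ t))) ([∘]ᶜT (lookupTyᶜ Γ i) pᶜ (σ ,ᶜ t)))
    (lookup-⊢t dσ i)

module _ {m n} {Δ : CCtx m} {Γ : CCtx n} {σ} (dσ : Δ ⊢ᶜ σ ∶ˢ Γ) where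
  mutual
    []-⊢T : ∀ {B} → Γ ⊢ᶜ B → Δ ⊢ᶜ (B [ σ ]ᶜT)
    []-⊢T (⋆ᶜ _)       = ⋆ᶜ (⊢s-ctx dσ)
    []-⊢T (Homᶜ dt du) = Homᶜ ([]-⊢t dt) ([]-⊢t du)

    []-⊢t : ∀ {t B} → Γ ⊢ᶜ t ∶ B → Δ ⊢ᶜ (t [ σ ]ᶜt) ∶ (B [ σ ]ᶜT)
    []-⊢t (varᶜ {i = i} _ e) = subst (λ X → Δ ⊢ᶜ lookupᶜ σ i ∶ (X [ σ ]ᶜT)) e (lookup-⊢t dσ i)
    []-⊢t (opᶜ {A = A'} {τ} oc dτ e)  = opᶜ oc (∘-⊢s dτ) (trans ([∘]ᶜT A' τ σ) (cong (_[ σ ]ᶜT) e))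
    []-⊢t (cohᶜ {A = A'} {τ} oc dτ e) = cohᶜ oc (∘-⊢s dτ) (trans ([∘]ᶜT A' τ σ) (cong (_[ σ ]ᶜT) e))

    ∘-⊢s : ∀ {k} {Θ : CCtx k} {τ} → Γ ⊢ᶜ τ ∶ˢ Θ → Δ ⊢ᶜ (τ ∘ᶜ σ) ∶ˢ Θ
    ∘-⊢s (⟨⟩ᶜ _) = ⟨⟩ᶜ (⊢s-ctx dσ)
    ∘-⊢s (extᶜ {σ = τ} {A = C} {t} dτ dC dt) =
      extᶜ (∘-⊢s dτ) dC (subst (Δ ⊢ᶜ (t [ σ ]ᶜt) ∶_) (sym ([∘]ᶜT C τ σ)) ([]-⊢t dt))

identitySides-isPullback : ∀ {X Y : Set} (f : X → Y) {l : X → X} {r : Y → Y} →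
                           (∀ x → l x ≡ x) → (∀ y → r y ≡ y) → IsPullback f l r f
identitySides-isPullback f l≗id r≗id =
  (λ c → trans (r≗id (f c)) (cong f (sym (l≗id c)))) ,
  (λ x y e → y , trans (sym e) (r≗id x) , l≗id y) ,
  (λ c c' _ e → trans (sym (l≗id c)) (trans e (l≗id c')))

module _ (F : Model) where
  open Model F

  displaySquare-isPullback :
    ∀ {m n} {Δ : CCtx m} {Γ : CCtx n} {E : CTy n} {S : CSub m n}
    (dE : Γ ⊢ᶜ E) (dS : Δ ⊢ᶜ S ∶ˢ Γ) {B : CTy m} (eB : B ≡ E [ S ]ᶜT)
    {q : CSub (suc m) n} {l : CSub (suc m) m} {r : CSub (suc n) n}
    (eq : q ≡ S ∘ᶜ pᶜ) (el : l ≡ pᶜ) (er : r ≡ pᶜ) →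
    Σ ((Δ ▸ B) ⊢ᶜ (q ,ᶜ var zero) ∶ˢ (Γ ▸ E)) λ dq →
    Σ ((Δ ▸ B) ⊢ᶜ l ∶ˢ Δ) λ dl →
    Σ ((Γ ▸ E) ⊢ᶜ r ∶ˢ Γ) λ dr →
    IsPullback (act dq) (act dl) (act dr) (act dS)
  displaySquare-isPullback {E = E} {S} dE dS refl refl refl refl =
    dq , dl , dr , pullback dE dS dq dl dr
    where
    dES = []-⊢T dS dE
    dl  = p-⊢s dES
    dr  = p-⊢s dE
    dq  = extᶜ (wk-⊢s dES dS) dE (varᶜ (▸ᶜ dES) (sym ([∘]ᶜT E S pᶜ)))

  identitySquare-isPullback :
    ∀ {m n} {Δ : CCtx m} {Γ : CCtx n} {S : CSub m n}
    (dΔ : Δ ⊢ᶜ) (dΓ : Γ ⊢ᶜ) (dS : Δ ⊢ᶜ S ∶ˢ Γ)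
    {q : CSub m n} {l : CSub m m} {r : CSub n n}
    (eq : q ≡ S) (el : l ≡ idᶜ) (er : r ≡ idᶜ) →
    Σ (Δ ⊢ᶜ q ∶ˢ Γ) λ dq →
    Σ (Δ ⊢ᶜ l ∶ˢ Δ) λ dl →
    Σ (Γ ⊢ᶜ r ∶ˢ Γ) λ dr →
    IsPullback (act dq) (act dl) (act dr) (act dS)
  identitySquare-isPullback dΔ dΓ dS refl refl refl =
    dS , dl , dr , identitySides-isPullback (act dS) (act-id dl) (act-id dr)
    where
    dl = id-⊢s dΔ
    dr = id-⊢s dΓ

mainTheorem17 : (F : Model) → FΣrPreservesDisplayPullbacks F
mainTheorem17 F {Δ = Δ} {Γ} {𝟙} {σ} (𝟙ᵐ dΓ) dσ =
  let dS = Σr-⊢s dσ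
      (dq , dl , dr , pb) = identitySquare-isPullback F (⊢s-ctx dS) (Σr-⊢C dΓ) dS
          (trans (ΣrSub-∘p Δ 𝟙 Γ σ) (∘ᶜ-identityʳ _)) (ΣrSub-p Δ 𝟙) (ΣrSub-p Γ 𝟙)
  in dq , dl , dr , dS , pb
mainTheorem17 F {Δ = Δ} {Γ} {A@(Homᵐ _ _ _)} {σ} dA dσ =
  let dS = Σr-⊢s dσ
      (dq , dl , dr , pb) = displaySquare-isPullback F (Σr-⊢T dA) dS
          (Σr-[]T (⊢s-isΣrOf dσ) A)
          (ΣrSub-∘p Δ (A [ σ ]ᵐT) Γ σ) (ΣrSub-p Δ _) (ΣrSub-p Γ _)
  in dq , dl , dr , dS , pb
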